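{- $\mathcal{N}\Vdash\forall x_1\forall x_2\forall y_1\forall y_2\,(\mathrm{op}(x_1,y_1)\simeq\mathrm{op}(x_2,y_2)\to(x_1\simeq x_2\wedge y_1\simeq y_2))$.
   Context: Setting (Krivine realizability) over a model $\mathbf{V}$ of ZF with realizability algebra $(\Lambda,\Pi,\succ,\perp\!\!\!\perp)$: $\Lambda$ closed $\lambda_c$-terms (variables, application, abstraction, $\mathsf{cc}$, continuation constants $\mathsf{k}_\pi$, possibly special instructions), $\Pi$ stacks (stack bottoms and $t\cdot\pi$), realizers $\mathcal{R}$ = terms without continuation constants, $\succ$ a preorder on processes containing $ts\star\pi\succ t\star s\cdot\pi$, $\lambda u.t\star s\cdot\pi\succ t[u:=s]\star\pi$, $\mathsf{cc}\star t\cdot\pi\succ t\star\mathsf{k}_\pi\cdot\pi$, $\mathsf{k}_\sigma\star t\cdot\pi\succ t\star\sigma$; pole $\perp\!\!\!\perp$ closed under anti-reduction. Church numerals $\underline0=\lambda u.\lambda v.v$, $\underline1=\lambda u.\lambda v.uv$. Names $\mathbf{N}=\bigcup_\alpha\mathbf{N}_\alpha$, $\mathbf{N}_\alpha=\bigcup_{\beta<\alpha}\mathcal{P}(\mathbf{N}_\beta\times\Pi)$. Falsity values of closed formulas with parameters in $\mathbf{N}$ (built with $\to,\forall$): $\|\perp\|=\Pi$, $\|a\notin b\|=\{t\cdot t'\cdot\pi:\exists c((c,\pi)\in b,t\Vdash a\subseteq c,t'\Vdash c\subseteq a)\}$, $\|a\subseteq b\|=\{t\cdot\pi:\exists c((c,\pi)\in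 a,t\Vdash c\notin b)\}$, $\|\varphi\to\psi\|=\{t\cdot\pi:t\Vdash\varphi,\pi\in\|\psi\|\}$, $\|\forall x\varphi\|=\bigcup_{a\in\mathbf{N}}\|\varphi(a)\|$; $t\Vdash\varphi$ iff $t\star\pi\in\perp\!\!\!\perp$ for all $\pi\in\|\varphi\|$; $\mathcal{N}\Vdash\varphi$ iff some realizer realizes $\varphi$. Abbreviations: $\varphi\wedge\psi:=(\varphi\to(\psi\to\perp))\to\perp$, $a\simeq b:=(a\subseteq b)\wedge(b\subseteq a)$. Operations on $\mathbf{N}$: $\mathrm{sng}(a)=\{a\}\times\Pi$; $\mathrm{up}(a,b)=\{(a,\underline0\cdot\pi):\pi\in\Pi\}\cup\{(b,\underline1\cdot\pi):\pi\in\Pi\}$; $\mathrm{op}(a,b)=\mathrm{up}(\mathrm{up}(\mathrm{sng}(a),\emptyset),\mathrm{sng}(\mathrm{sng}(b)))$. These may occur in formulas and are evaluated on parameters in $\mathbf{V}$. -}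

module Defs where

open import Level using (Level; Lift; lift) renaming (suc to lsuc; zero to lzero)
open import Data.Nat using (ℕ; zero; suc)
open import Data.Fin using (Fin; zero; suc)
open import Data.Bool using (Bool; true; false)
open import Data.Empty using (⊥)
open import Data.Unit using (⊤)
open import Data.Product using (Σ; _×_; _,_; proj₁; proj₂)
open import Relation.Binary.PropositionalEquality using (_≡_)

module Syntax (Instr Bot : Set) where

  mutual
    data Tm (n : ℕ) : Set where
      var   : Fin n → Tm n
      app   : Tm n → Tm n → Tm n
      lam   : Tm (suc n) → Tm n
      cc    : Tm n
      k     : Stack → Tm n
      instr : Instr → Tm n

    data Stack : Set where
      bot  : Bot → Stack
      _∙_  : Tm 0 → Stack → Stack

  infixr 5 _∙_

  Λ : Set
  Λ = Tm 0

  Proc : Set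
  Proc = Λ × Stack

  _⋆_ : Λ → Stack → Proc
  t ⋆ π = t , π

  Ren : ℕ → ℕ → Set
  Ren m n = Fin m → Fin n

  liftR : ∀ {m n} → Ren m n → Ren (suc m) (suc n)
  liftR ρ zero    = zero
  liftR ρ (suc i) = suc (ρ i)

  ren : ∀ {m n} → Ren m n → Tm m → Tm n
  ren ρ (var i)   = var (ρ i)
  ren ρ (app t u) = app (ren ρ t) (ren ρ u)
  ren ρ (lam t)   = lam (ren (liftR ρ) t)
  ren ρ cc        = cc
  ren ρ (k π)     = k π
  ren ρ (instr c) = instr c

  Sub : ℕ → ℕ → Set
  Sub m n = Fin m → Tm n

  liftS : ∀ {m n} → Sub m n → Sub (suc m) (suc n)
  liftS σ zero    = var zero
  liftS σ (suc i) = ren suc (σ i)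

  sub : ∀ {m n} → Sub m n → Tm m → Tm n
  sub σ (var i)   = σ i
  sub σ (app t u) = app (sub σ t) (sub σ u)
  sub σ (lam t)   = lam (sub (liftS σ) t)
  sub σ cc        = cc
  sub σ (k π)     = k π
  sub σ (instr c) = instr c

  _[_] : Tm 1 → Λ → Λ
  t [ s ] = sub (λ { zero → s }) t

  -- realizers: terms containing no continuation constant
  NoK : ∀ {n} → Tm n → Set
  NoK (var i)   = ⊤
  NoK (app t u) = NoK t × NoK u
  NoK (lam t)   = NoK t
  NoK cc        = ⊤
  NoK (k π)     = ⊥
  NoK (instr c) = ⊤

  church0 church1 : Λ
  church0 = lam (lam (var zero))
  church1 = lam (lam (app (var (suc zero)) (var zero)))

record RealizabilityAlgebra : Set₁ where
  field
    Instr : Set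
    Bot   : Set
  open Syntax Instr Bot public
  field
    _≻_       : Proc → Proc → Set
    ≻-refl    : ∀ p → p ≻ p
    ≻-trans   : ∀ {p q r} → p ≻ q → q ≻ r → p ≻ r
    ≻-push    : ∀ t s π → (app t s ⋆ π) ≻ (t ⋆ (s ∙ π))
    ≻-grab    : ∀ (t : Tm 1) s π → (lam t ⋆ (s ∙ π)) ≻ ((t [ s ]) ⋆ π)
    ≻-save    : ∀ t π → (cc ⋆ (t ∙ π)) ≻ (t ⋆ (k π ∙ π))
    ≻-restore : ∀ σ t π → (k σ ⋆ (t ∙ π)) ≻ (t ⋆ σ)
    Pole      : Proc → Set
    Pole-anti : ∀ {p q} → p ≻ q → Pole q → Pole p

module Realizability (A : RealizabilityAlgebra) where
  open RealizabilityAlgebra A public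

  -- A name is a (family-presented) set of pairs (name, stack):
  -- sup I f g = { (f i , g i) : i ∈ I }.
  data Name : Set₁ where
    sup : (I : Set) → (I → Name) → (I → Stack) → Name

  FV : Set₂
  FV = Stack → Set₁

  _⊩_ : Λ → FV → Set₁
  t ⊩ φ = ∀ π → φ π → Pole (t ⋆ π)

  mutual
    ‖_∉_‖ : Name → Name → FV
    ‖ a ∉ sup J g h ‖ ρ =
      Σ J λ j → Σ Λ λ t → Σ Λ λ t' →
        (ρ ≡ t ∙ t' ∙ h j)
        × (∀ π → ‖ a ⊆ g j ‖ π → Pole (t ⋆ π))
        × (∀ π → ‖ g j ⊆ a ‖ π → Pole (t' ⋆ π))

    ‖_⊆_‖ : Name → Name → FV
    ‖ sup I f g ⊆ b ‖ ρ =
      Σ I λ i → Σ Λ λ t →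
        (ρ ≡ t ∙ g i) × (∀ π → ‖ f i ∉ b ‖ π → Pole (t ⋆ π))

  ‖⊥‖ : FV
  ‖⊥‖ _ = Lift _ ⊤

  _⇒_ : FV → FV → FV
  (φ ⇒ ψ) ρ = Σ Λ λ t → Σ Stack λ π → (ρ ≡ t ∙ π) × (t ⊩ φ) × ψ π
  infixr 4 _⇒_

  ∀N : (Name → FV) → FV
  ∀N φ ρ = Σ Name λ a → φ a ρ

  _∧_ : FV → FV → FV
  φ ∧ ψ = (φ ⇒ (ψ ⇒ ‖⊥‖)) ⇒ ‖⊥‖
  infixr 6 _∧_

  ‖_≃_‖ : Name → Name → FV
  ‖ a ≃ b ‖ = ‖ a ⊆ b ‖ ∧ ‖ b ⊆ a ‖

  𝒩⊩ : FV → Set₁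
  𝒩⊩ φ = Σ Λ λ t → NoK t × (t ⊩ φ)

  ∅N : Name
  ∅N = sup ⊥ (λ ()) (λ ())

  sng : Name → Name
  sng a = sup Stack (λ _ → a) (λ π → π)

  up : Name → Name → Name
  up a b = sup (Bool × Stack)
    (λ { (true , π) → a ; (false , π) → b })
    (λ { (true , π) → church0 ∙ π ; (false , π) → church1 ∙ π })

  op : Name → Name → Name
  op a b = up (up (sng a) ∅N) (sng (sng b))

-- Write op a b = up (U a) (S b) with U a = up {a} ∅ and S b = {{b}}; the members of
-- an up-pair are tagged by the Church numerals 0 and 1 on the stack.  Only the
-- inclusion op x₁ y₁ ⊆ op x₂ y₂ is needed.  To get x₁ ≃ x₂, feed it the member U x₁
-- together with a realizer of U x₁ ∉ op x₂ y₂; such a realizer branches on the tag and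
-- refutes U x₁ ≃ U x₂ (through {x₁} ∉ U x₂, i.e. x₁ ≄ x₂) and U x₁ ≃ S y₂ (the member ∅
-- of U x₁ is not in S y₂, whose only member {y₂} is inhabited).  The member S y₁ gives
-- y₁ ≃ y₂ in the same way.
module Submission where

open import Defs
open import Level using (lift)
open import Data.Nat using (suc)
open import Data.Fin using (zero; suc)
open import Data.Bool using (true; false)
open import Data.Unit using (tt)
open import Data.Product using (_,_)
open import Function using (_∘_)
open import Relation.Binary.PropositionalEquality using (_≡_; refl; cong; cong₂; trans; sym; subst)

module _ (A : RealizabilityAlgebra) where
  open Realizability A

  ren-cong : ∀ {m n} {ρ ρ' : Ren m n} → (∀ i → ρ i ≡ ρ' i) → ∀ t → ren ρ t ≡ ren ρ' t
  ren-cong e (var i)   = cong var (e i)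
  ren-cong e (app t u) = cong₂ app (ren-cong e t) (ren-cong e u)
  ren-cong e (lam t)   = cong lam (ren-cong (λ { zero → refl ; (suc i) → cong suc (e i) }) t)
  ren-cong e cc        = refl
  ren-cong e (k π)     = refl
  ren-cong e (instr c) = refl

  sub-cong : ∀ {m n} {σ σ' : Sub m n} → (∀ i → σ i ≡ σ' i) → ∀ t → sub σ t ≡ sub σ' t
  sub-cong e (var i)   = e i
  sub-cong e (app t u) = cong₂ app (sub-cong e t) (sub-cong e u)
  sub-cong e (lam t)   = cong lam (sub-cong (λ { zero → refl ; (suc i) → cong (ren suc) (e i) }) t)
  sub-cong e cc        = refl
  sub-cong e (k π)     = refl
  sub-cong e (instr c) = refl

  ren-ren : ∀ {l m n} (ρ : Ren m n) (ρ' : Ren l m) t → ren ρ (ren ρ' t) ≡ ren (ρ ∘ ρ') t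
  ren-ren ρ ρ' (var i)   = refl
  ren-ren ρ ρ' (app t u) = cong₂ app (ren-ren ρ ρ' t) (ren-ren ρ ρ' u)
  ren-ren ρ ρ' (lam t)   =
    cong lam (trans (ren-ren (liftR ρ) (liftR ρ') t) (ren-cong (λ { zero → refl ; (suc i) → refl }) t))
  ren-ren ρ ρ' cc        = refl
  ren-ren ρ ρ' (k π)     = refl
  ren-ren ρ ρ' (instr c) = refl

  sub-ren : ∀ {l m n} (σ : Sub m n) (ρ : Ren l m) t → sub σ (ren ρ t) ≡ sub (σ ∘ ρ) t
  sub-ren σ ρ (var i)   = refl
  sub-ren σ ρ (app t u) = cong₂ app (sub-ren σ ρ t) (sub-ren σ ρ u)
  sub-ren σ ρ (lam t)   =
    cong lam (trans (sub-ren (liftS σ) (liftR ρ) t) (sub-cong (λ { zero → refl ; (suc i) → refl }) t))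
  sub-ren σ ρ cc        = refl
  sub-ren σ ρ (k π)     = refl
  sub-ren σ ρ (instr c) = refl

  ren-sub : ∀ {l m n} (ρ : Ren m n) (σ : Sub l m) t → ren ρ (sub σ t) ≡ sub (ren ρ ∘ σ) t
  ren-sub ρ σ (var i)   = refl
  ren-sub ρ σ (app t u) = cong₂ app (ren-sub ρ σ t) (ren-sub ρ σ u)
  ren-sub ρ σ (lam t)   = cong lam (trans (ren-sub (liftR ρ) (liftS σ) t) (sub-cong lift-comm t))
    where
    lift-comm : ∀ i → ren (liftR ρ) (liftS σ i) ≡ liftS (ren ρ ∘ σ) i
    lift-comm zero    = refl
    lift-comm (suc i) = trans (ren-ren (liftR ρ) suc (σ i)) (sym (ren-ren suc ρ (σ i)))
  ren-sub ρ σ cc        = refl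
  ren-sub ρ σ (k π)     = refl
  ren-sub ρ σ (instr c) = refl

  sub-sub : ∀ {l m n} (τ : Sub m n) (σ : Sub l m) t → sub τ (sub σ t) ≡ sub (sub τ ∘ σ) t
  sub-sub τ σ (var i)   = refl
  sub-sub τ σ (app t u) = cong₂ app (sub-sub τ σ t) (sub-sub τ σ u)
  sub-sub τ σ (lam t)   = cong lam (trans (sub-sub (liftS τ) (liftS σ) t) (sub-cong lift-comm t))
    where
    lift-comm : ∀ i → sub (liftS τ) (liftS σ i) ≡ liftS (sub τ ∘ σ) i
    lift-comm zero    = refl
    lift-comm (suc i) = trans (sub-ren (liftS τ) suc (σ i)) (sym (ren-sub suc τ (σ i)))
  sub-sub τ σ cc        = refl
  sub-sub τ σ (k π)     = refl
  sub-sub τ σ (instr c) = refl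

  sub-id : ∀ {n} {σ : Sub n n} → (∀ i → σ i ≡ var i) → ∀ t → sub σ t ≡ t
  sub-id e (var i)   = e i
  sub-id e (app t u) = cong₂ app (sub-id e t) (sub-id e u)
  sub-id e (lam t)   = cong lam (sub-id (λ { zero → refl ; (suc i) → cong (ren suc) (e i) }) t)
  sub-id e cc        = refl
  sub-id e (k π)     = refl
  sub-id e (instr c) = refl

  ε : ∀ {m} → Sub 0 m
  ε ()

  _▸_ : ∀ {n m} → Sub n m → Tm m → Sub (suc n) m
  (σ ▸ a) zero    = a
  (σ ▸ a) (suc i) = σ i
  infixl 5 _▸_

  sub-liftS-sub : ∀ {n} (σ : Sub n 0) (τ : Sub 1 0) t → sub τ (sub (liftS σ) t) ≡ sub (σ ▸ τ zero) t
  sub-liftS-sub σ τ t = trans (sub-sub τ (liftS σ) t) (sub-cong instantiate t)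
    where
    instantiate : ∀ i → sub τ (liftS σ i) ≡ (σ ▸ τ zero) i
    instantiate zero    = refl
    instantiate (suc i) = trans (sub-ren τ suc (σ i)) (sub-id (λ ()) (σ i))

  Pole-push : ∀ {t s π} → Pole (t ⋆ (s ∙ π)) → Pole (app t s ⋆ π)
  Pole-push = Pole-anti (≻-push _ _ _)

  Pole-grab-under : ∀ {n} (σ : Sub n 0) {t : Tm (suc n)} {a π} →
    Pole (sub (σ ▸ a) t ⋆ π) → Pole (sub σ (lam t) ⋆ (a ∙ π))
  Pole-grab-under σ {t} {a} {π} h =
    Pole-anti (≻-grab _ a π) (subst (λ u → Pole (u ⋆ π)) (sym (sub-liftS-sub σ _ t)) h)

  Pole-grab₁ : ∀ {t : Tm 1} {a π} → Pole (sub (ε ▸ a) t ⋆ π) → Pole (lam t ⋆ (a ∙ π))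
  Pole-grab₁ {t} {a} {π} h =
    subst (λ u → Pole (u ⋆ (a ∙ π))) (sub-id (λ ()) (lam t)) (Pole-grab-under ε {t} h)

  Pole-grab₂ : ∀ {t : Tm 2} {a b π} →
    Pole (sub (ε ▸ a ▸ b) t ⋆ π) → Pole (lam (lam t) ⋆ (a ∙ b ∙ π))
  Pole-grab₂ {t} {a} = Pole-grab₁ ∘ Pole-grab-under (ε ▸ a) {t}

  Pole-grab₃ : ∀ {t : Tm 3} {a b c π} →
    Pole (sub (ε ▸ a ▸ b ▸ c) t ⋆ π) → Pole (lam (lam (lam t)) ⋆ (a ∙ b ∙ c ∙ π))
  Pole-grab₃ {t} {a} {b} = Pole-grab₂ ∘ Pole-grab-under (ε ▸ a ▸ b) {t}

  Pole-grab₄ : ∀ {t : Tm 4} {a b c d π} →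
    Pole (sub (ε ▸ a ▸ b ▸ c ▸ d) t ⋆ π) → Pole (lam (lam (lam (lam t))) ⋆ (a ∙ b ∙ c ∙ d ∙ π))
  Pole-grab₄ {t} {a} {b} {c} = Pole-grab₃ ∘ Pole-grab-under (ε ▸ a ▸ b ▸ c) {t}

  Pole-grab₅ : ∀ {t : Tm 5} {a b c d e π} →
    Pole (sub (ε ▸ a ▸ b ▸ c ▸ d ▸ e) t ⋆ π) →
    Pole (lam (lam (lam (lam (lam t)))) ⋆ (a ∙ b ∙ c ∙ d ∙ e ∙ π))
  Pole-grab₅ {t} {a} {b} {c} {d} = Pole-grab₄ ∘ Pole-grab-under (ε ▸ a ▸ b ▸ c ▸ d) {t}

  v₀ : ∀ {n} → Tm (suc n)
  v₀ = var zero
  v₁ : ∀ {n} → Tm (suc (suc n))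
  v₁ = var (suc zero)
  v₂ : ∀ {n} → Tm (suc (suc (suc n)))
  v₂ = var (suc (suc zero))
  v₃ : ∀ {n} → Tm (suc (suc (suc (suc n))))
  v₃ = var (suc (suc (suc zero)))
  v₄ : ∀ {n} → Tm (suc (suc (suc (suc (suc n)))))
  v₄ = var (suc (suc (suc (suc zero))))

  𝟘 𝟙 : ∀ {n} → Tm n
  𝟘 = lam (lam v₀)
  𝟙 = lam (lam (app v₁ v₀))

  U S : Name → Name
  U a = up (sng a) ∅N
  S b = sng (sng b)

  -- ‖ a ≃ b ‖ is definitionally ‖ a ≄ b ‖ ⇒ ‖⊥‖.
  ‖_≄_‖ : Name → Name → FV
  ‖ a ≄ b ‖ = ‖ a ⊆ b ‖ ⇒ ‖ b ⊆ a ‖ ⇒ ‖⊥‖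

  ⊩-∉∅ : ∀ t a → t ⊩ ‖ a ∉ ∅N ‖
  ⊩-∉∅ t a π (() , _)

  ≄⇒∉sng : ∀ {w} a b → w ⊩ ‖ a ≄ b ‖ → w ⊩ ‖ a ∉ sng b ‖
  ≄⇒∉sng a b hw _ (ρ , u , u' , refl , hu , hu') =
    hw _ (u , _ , refl , hu , u' , ρ , refl , hu' , lift tt)

  ∉up-r : ∀ {n} → Tm n
  ∉up-r = lam (lam (lam (lam (lam (app (app v₀ (app (app v₃ v₂) v₁)) (app (app v₄ v₂) v₁))))))

  -- Church 1 applies its first argument to the second instead of selecting it, so the
  -- tag-1 branch runs on a longer stack; this is harmless since ‖⊥‖ contains every stack.
  ⊩-∉up : ∀ {f₀ f₁} a c d → f₀ ⊩ ‖ a ≄ c ‖ → f₁ ⊩ ‖ a ≄ d ‖ → app (app ∉up-r f₀) f₁ ⊩ ‖ a ∉ up c d ‖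
  ⊩-∉up a c d h₀ h₁ _ ((true , ρ) , u , u' , refl , hu , hu') =
    Pole-push (Pole-push (Pole-grab₅ (Pole-push (Pole-push (Pole-grab₂
      (Pole-push (Pole-push (h₀ _ (u , _ , refl , hu , u' , ρ , refl , hu' , lift tt)))))))))
  ⊩-∉up a c d h₀ h₁ _ ((false , ρ) , u , u' , refl , hu , hu') =
    Pole-push (Pole-push (Pole-grab₅ (Pole-push (Pole-push (Pole-grab₂
      (Pole-push (Pole-push (Pole-push (h₁ _ (u , _ , refl , hu , u' , _ , refl , hu' , lift tt))))))))))

  ≄-sym-r : ∀ {n} → Tm n
  ≄-sym-r = lam (lam (lam (app (app v₂ v₀) v₁)))

  ⊩-≄-sym : ∀ {f} a b → f ⊩ ‖ a ≄ b ‖ → app ≄-sym-r f ⊩ ‖ b ≄ a ‖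
  ⊩-≄-sym a b hf _ (u , _ , refl , hu , u' , ρ , refl , hu' , _) =
    Pole-push (Pole-grab₃ (Pole-push (Pole-push (hf _ (u' , _ , refl , hu' , u , ρ , refl , hu , lift tt)))))

  sng∉-r : ∀ {n} → Tm n
  sng∉-r = lam (lam (lam (app v₁ v₂)))

  ⊩-sng∉ : ∀ {t a J g h} → (∀ j → t ⊩ ‖ a ∉ g j ‖) → app sng∉-r t ⊩ ‖ sng a ∉ sup J g h ‖
  ⊩-sng∉ {h = h} ht _ (j , z , _ , refl , hz , _) =
    Pole-push (Pole-grab₃ (Pole-push (hz _ (h j , _ , refl , ht j))))

  ∅∉S-r : ∀ {n} → Tm n
  ∅∉S-r = lam (lam (app v₀ v₁))

  -- S b ⊆ ∅ is refuted at the member sng b, which occurs with every stack.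
  ⊩-∅∉S : ∀ b → ∅∉S-r ⊩ ‖ ∅N ∉ S b ‖
  ⊩-∅∉S b _ (ρ , a , _ , refl , _ , ha') = Pole-grab₂ (Pole-push (ha' _ (ρ , a , refl , ⊩-∉∅ a b)))

  U≄S-r : ∀ {n} → Tm n
  U≄S-r = lam (lam (app (app v₁ ∅∉S-r) 𝟙))

  ⊩-U≄S : ∀ a b → U≄S-r ⊩ ‖ U a ≄ S b ‖
  ⊩-U≄S a b _ (u , _ , refl , hu , _ , ρ , refl , _) =
    Pole-grab₂ (Pole-push (Pole-push (hu _ ((false , ρ) , ∅∉S-r , refl , ⊩-∅∉S b))))

  sng≄-r : ∀ {n} → Tm n
  sng≄-r = lam (lam (lam (app (app v₁ (app sng∉-r v₂)) 𝟘)))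

  ⊩-U≄U : ∀ {t} a b → t ⊩ ‖ a ∉ sng b ‖ → app sng≄-r t ⊩ ‖ U a ≄ U b ‖
  ⊩-U≄U {t} a b ht _ (u , _ , refl , hu , _ , ρ , refl , _) =
    Pole-push (Pole-grab₃ (Pole-push (Pole-push (hu _ ((true , ρ) , _ , refl ,
      ⊩-sng∉ λ { (true , _) → ht ; (false , _) → ⊩-∉∅ t a })))))

  ⊩-S≄S : ∀ {t} a b → t ⊩ ‖ a ∉ sng b ‖ → app sng≄-r t ⊩ ‖ S a ≄ S b ‖
  ⊩-S≄S a b ht _ (u , _ , refl , hu , _ , ρ , refl , _) =
    Pole-push (Pole-grab₃ (Pole-push (Pole-push (hu _ (_ , _ , refl , ⊩-sng∉ λ _ → ht)))))

  op-inj₁-r : ∀ {n} → Tm n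
  op-inj₁-r = lam (lam (app (app v₁ (app (app ∉up-r (app sng≄-r v₀)) U≄S-r)) 𝟘))

  ⊩-op-inj₁ : ∀ {p} x₁ x₂ y₁ y₂ → p ⊩ ‖ op x₁ y₁ ⊆ op x₂ y₂ ‖ → app op-inj₁-r p ⊩ ‖ x₁ ≃ x₂ ‖
  ⊩-op-inj₁ x₁ x₂ y₁ y₂ hp _ (w , ρ , refl , hw , _) =
    Pole-push (Pole-grab₂ (Pole-push (Pole-push (hp _ ((true , ρ) , _ , refl , U∉op)))))
    where
    U∉op : app (app ∉up-r (app sng≄-r w)) U≄S-r ⊩ ‖ U x₁ ∉ op x₂ y₂ ‖
    U∉op = ⊩-∉up (U x₁) (U x₂) (S y₂) (⊩-U≄U x₁ x₂ (≄⇒∉sng x₁ x₂ hw)) (⊩-U≄S x₁ y₂)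

  op-inj₂-r : ∀ {n} → Tm n
  op-inj₂-r = lam (lam (app (app v₁ (app (app ∉up-r (app ≄-sym-r U≄S-r)) (app sng≄-r v₀))) 𝟙))

  ⊩-op-inj₂ : ∀ {p} x₁ x₂ y₁ y₂ → p ⊩ ‖ op x₁ y₁ ⊆ op x₂ y₂ ‖ → app op-inj₂-r p ⊩ ‖ y₁ ≃ y₂ ‖
  ⊩-op-inj₂ x₁ x₂ y₁ y₂ hp _ (w , ρ , refl , hw , _) =
    Pole-push (Pole-grab₂ (Pole-push (Pole-push (hp _ ((false , ρ) , _ , refl , S∉op)))))
    where
    S∉op : app (app ∉up-r (app ≄-sym-r U≄S-r)) (app sng≄-r w) ⊩ ‖ S y₁ ∉ op x₂ y₂ ‖
    S∉op = ⊩-∉up (S y₁) (U x₂) (S y₂) (⊩-≄-sym (U x₂) (S y₁) (⊩-U≄S x₂ y₁))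
                                     (⊩-S≄S y₁ y₂ (≄⇒∉sng y₁ y₂ hw))

  op≄-r : ∀ {n} → Tm n
  op≄-r = lam (lam (lam (app (app v₂ (app op-inj₁-r v₁)) (app op-inj₂-r v₁))))

  ⊩-op≄ : ∀ {s} x₁ x₂ y₁ y₂ → s ⊩ (‖ x₁ ≃ x₂ ‖ ⇒ ‖ y₁ ≃ y₂ ‖ ⇒ ‖⊥‖) →
    app op≄-r s ⊩ ‖ op x₁ y₁ ≄ op x₂ y₂ ‖
  ⊩-op≄ x₁ x₂ y₁ y₂ hs _ (p , _ , refl , hp , q , ρ , refl , _) =
    Pole-push (Pole-grab₃ (Pole-push (Pole-push (hs _
      (_ , _ , refl , ⊩-op-inj₁ x₁ x₂ y₁ y₂ hp , _ , ρ , refl , ⊩-op-inj₂ x₁ x₂ y₁ y₂ hp , lift tt)))))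

  op-inj-r : ∀ {n} → Tm n
  op-inj-r = lam (lam (app v₁ (app op≄-r v₀)))

  ⊩-op-inj : op-inj-r ⊩ (∀N λ x₁ → ∀N λ x₂ → ∀N λ y₁ → ∀N λ y₂ →
    (‖ op x₁ y₁ ≃ op x₂ y₂ ‖ ⇒ (‖ x₁ ≃ x₂ ‖ ∧ ‖ y₁ ≃ y₂ ‖)))
  ⊩-op-inj _ (x₁ , x₂ , y₁ , y₂ , t , _ , refl , ht , s , ρ , refl , hs , _) =
    Pole-grab₂ (Pole-push (ht _ (_ , ρ , refl , ⊩-op≄ x₁ x₂ y₁ y₂ hs , lift tt)))

proposition14p8 : (A : RealizabilityAlgebra) → let open Realizability A in
    𝒩⊩ (∀N λ x₁ → ∀N λ x₂ → ∀N λ y₁ → ∀N λ y₂ →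
      (‖ op x₁ y₁ ≃ op x₂ y₂ ‖ ⇒ (‖ x₁ ≃ x₂ ‖ ∧ ‖ y₁ ≃ y₂ ‖)))
proposition14p8 A = op-inj-r A , _ , ⊩-op-inj A
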